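{- Let $S$ be a finite sphere-like poset of rank $k$. Then for every $\eta\in C_{k-1}$ with $d_{k-1}(\eta)=0$ there exists $\xi\in C_k$ with $d_k(\xi)=\eta$.
   Context: A ranked poset is a poset with rank function $\operatorname{rk}$ such that $x<y$ implies $\operatorname{rk}(x)<\operatorname{rk}(y)$ and $x\lessdot y$ ($y$ covers $x$) implies $\operatorname{rk}(y)=\operatorname{rk}(x)+1$; its rank is the maximum rank of an element. $\Delta(x)=\{z:z\lessdot x\}$. For $0\le q\le k$, $S_q$ is the set of elements of rank $q$, $C_q$ is the $\mathbb{Z}_2$-vector space with basis $S_q$, and $d_q:C_q\to C_{q-1}$ is the linear map with $d_q(x)=\sum_{z\in\Delta(x)}z$ for $x\in S_q$. A matching on $S$ is a set $\mathcal{M}$ of ordered pairs $(a,b)$ with $a\lessdot b$, each element in at most one pair. An $\mathcal{M}$-path is a sequence $y_0,x_1,y_1,\ldots,x_r,y_r$ ($r\ge0$) with $(x_i,y_i)\in\mathcal{M}$, $x_i\lessdot y_{i-1}$, $y_{i-1}\ne y_i$. $\mathcal{M}$ is acyclic if no $\mathcal{M}$-path has $r>0$ and $y_r=y_0$; an element is $\mathcal{M}$-critical if it lies in no pair. A ranked poset $S$ of rank $k\ge2$ is sphere-like if: (i) each element of rank $k-1$ is covered by exactly two elements; (ii) for each $y$ of rank $k$ and $z$ of rank $k-2$, the number of $x$ of rank $k-1$ with $z\lessdot x\lessdot y$ is even; (iii) there exists an acyclic matching on $S$ such that no element of rank $k-1$ is critical for it. -}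

module Defs where

open import Data.Nat using (ℕ; zero; suc; _≤_; _<_; _∸_; _+_; _≟_)
open import Data.Nat.Divisibility using (_∣_)
open import Data.Fin using (Fin)
import Data.Fin as F
open import Data.Fin.Properties using (all?)
open import Data.Bool using (Bool; true; false; _xor_; _∧_; if_then_else_)
open import Data.Product using (Σ; ∃; _×_; _,_)
open import Data.Sum using (_⊎_)
open import Relation.Nullary using (¬_; Dec; yes; no)
open import Relation.Nullary.Decidable using (⌊_⌋; ¬?; _×-dec_)
open import Relation.Binary using (Rel; Decidable; IsStrictPartialOrder)
open import Relation.Binary.PropositionalEquality using (_≡_; _≢_)
open import Level using (0ℓ)

parity : ∀ {n} → (Fin n → Bool) → Bool
parity {zero}  f = false
parity {suc n} f = f F.zero xor parity (λ i → f (F.suc i))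

count : ∀ {n} → (Fin n → Bool) → ℕ
count {zero}  f = 0
count {suc n} f = (if f F.zero then 1 else 0) + count (λ i → f (F.suc i))

record FinPoset (n : ℕ) : Set₁ where
  field
    _≺_   : Rel (Fin n) 0ℓ
    _≺?_  : Decidable _≺_
    isSPO : IsStrictPartialOrder _≡_ _≺_

  _⋖_ : Fin n → Fin n → Set
  x ⋖ y = (x ≺ y) × (∀ z → ¬ ((x ≺ z) × (z ≺ y)))

  _⋖?_ : Decidable _⋖_
  x ⋖? y = (x ≺? y) ×-dec all? (λ z → ¬? ((x ≺? z) ×-dec (z ≺? y)))

record IsRanked {n} (P : FinPoset n) (rk : Fin n → ℕ) : Set where
  open FinPoset P
  field
    rk-mono  : ∀ {x y} → x ≺ y → rk x < rk y
    rk-cover : ∀ {x y} → x ⋖ y → rk y ≡ suc (rk x)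

HasRank : ∀ {n} → (Fin n → ℕ) → ℕ → Set
HasRank {n} rk k = (∃ λ (x : Fin n) → rk x ≡ k) × (∀ x → rk x ≤ k)

module _ {n : ℕ} (P : FinPoset n) (rk : Fin n → ℕ) where
  open FinPoset P

  -- C_q : ℤ₂-chains supported on S_q (represented as subsets of S)
  IsChain : ℕ → (Fin n → Bool) → Set
  IsChain q ξ = ∀ x → ξ x ≡ true → rk x ≡ q

  -- boundary: d(ξ)(z) = Σ_{x ∈ ξ, z ⋖ x} 1  in ℤ₂
  -- (for ξ ∈ C_q this is d_q ξ ∈ C_{q-1}, as z ⋖ x forces rk z = q - 1)
  bd : (Fin n → Bool) → (Fin n → Bool)
  bd ξ z = parity (λ x → ξ x ∧ ⌊ z ⋖? x ⌋)

  InPair : (Fin n → Fin n → Bool) → Fin n → Fin n → Set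
  InPair M a b = M a b ≡ true

  record IsMatching (M : Fin n → Fin n → Bool) : Set where
    field
      pair-cover : ∀ {a b} → InPair M a b → a ⋖ b
      at-most-one : ∀ {a b c d} → InPair M a b → InPair M c d →
                    (a ≡ c ⊎ a ≡ d ⊎ b ≡ c ⊎ b ≡ d) → (a ≡ c × b ≡ d)

  -- M-paths  y₀, x₁, y₁, …, x_r, y_r  from y₀ to y_r of length r
  data MPath (M : Fin n → Fin n → Bool) : Fin n → Fin n → ℕ → Set where
    stop : ∀ y → MPath M y y 0
    step : ∀ {r y₀ x₁ y₁ y} → InPair M x₁ y₁ → x₁ ⋖ y₀ → y₀ ≢ y₁ →
           MPath M y₁ y r → MPath M y₀ y (suc r)

  Acyclic : (Fin n → Fin n → Bool) → Set
  Acyclic M = ∀ y r → MPath M y y (suc r) → ⊥'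
    where open import Data.Empty renaming (⊥ to ⊥')

  Critical : (Fin n → Fin n → Bool) → Fin n → Set
  Critical M e = (∀ b → ¬ InPair M e b) × (∀ a → ¬ InPair M a e)

  record SphereLike (k : ℕ) : Set where
    field
      k≥2    : 2 ≤ k
      rank-k : HasRank rk k
      two-covers : ∀ x → rk x ≡ k ∸ 1 →
        Σ (Fin n) λ y₁ → Σ (Fin n) λ y₂ → y₁ ≢ y₂ × x ⋖ y₁ × x ⋖ y₂ ×
          (∀ y → x ⋖ y → y ≡ y₁ ⊎ y ≡ y₂)
      diamond : ∀ y z → rk y ≡ k → rk z ≡ k ∸ 2 →
        2 ∣ count (λ x → ⌊ rk x ≟ (k ∸ 1) ⌋ ∧ ⌊ z ⋖? x ⌋ ∧ ⌊ x ⋖? y ⌋)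
      matching : Σ (Fin n → Fin n → Bool) λ M →
        IsMatching M × Acyclic M × (∀ x → rk x ≡ k ∸ 1 → ¬ Critical M x)

-- Fix an acyclic matching M leaving no element of rank k - 1 critical.  Each
-- x of rank k - 1 has exactly two covers y and y′, so (dξ)(x) = ξ(y) + ξ(y′);
-- hence when (x , y) ∈ M the value ξ(y) := η(x) + ξ(y′) forces (dξ)(x) = η(x),
-- and ξ := 0 on the other elements of rank k.  This recursion runs along
-- M-path steps y′ → y, which are well-founded because M is acyclic and S is
-- finite.  Then θ = η + dξ is a cycle (dd = 0 by the diamond condition) that
-- vanishes on every x matched upwards.  An x with θ(x) = 1 would be matched
-- downwards to some a; as (dθ)(a) = 0, another cover x′ of a has θ(x′) = 1,
-- and x′ → x is again an M-path step, so well-founded induction rules it out.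
-- Therefore θ = 0, i.e. dξ = η.
{-# OPTIONS --safe #-}
module Submission where

open import Algebra.Bundles using (CommutativeRing)
open import Data.Bool using (Bool; true; false; not; _xor_; _∧_; if_then_else_)
import Data.Bool as Bool
open import Data.Bool.Properties
  using (xor-∧-commutativeRing; xor-identityʳ; xor-same; xor-assoc; not-injective;
         ∧-identityʳ; ∧-zeroʳ; ∧-assoc; ∧-distribʳ-xor; ¬-not)
open import Data.Fin using (Fin; zero; suc; punchIn; punchOut)
open import Data.Fin.Induction using (spo-wellFounded)
open import Data.Fin.Properties using (any?; punchInᵢ≢i; punchIn-injective; punchIn-punchOut)
open import Data.Nat using (ℕ; zero; suc; _+_; _∸_; _≟_)
open import Data.Nat.Divisibility using (_∣_; ∣m+n∣m⇒∣n; ∣-refl; ∣1⇒≡1)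
open import Data.Nat.Properties using (m+[n∸m]≡n; <⇒≤)
open import Data.Product using (Σ; ∃; _×_; _,_; proj₁; proj₂)
open import Data.Sum using (_⊎_; inj₁; inj₂; swap)
open import Data.Vec.Functional using (removeAt)
open import Function using (_∘_)
open import Induction.WellFounded using (WellFounded; WfRec; module All; module FixPoint)
open import Level using (0ℓ)
open import Relation.Binary using (Rel; IsStrictPartialOrder)
open import Relation.Binary.Construct.Closure.Transitive using (TransClosure; [_]; _∷_; _++_; wellFounded⁻)
open import Relation.Binary.PropositionalEquality
open import Relation.Nullary using (Dec; yes; no; ¬_; contradiction)
open import Relation.Nullary.Decidable using (⌊_⌋; _×-dec_; dec-true; isYes≗does)

open import Defs

open import Algebra.Properties.Semiring.Sum (CommutativeRing.semiring xor-∧-commutativeRing)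
  using (sum; sum-cong-≗; sum-replicate-zero; sum-remove; ∑-distrib-+; ∑-comm;
         *-distribˡ-sum; *-distribʳ-sum)

open ≡-Reasoning

private variable
  n : ℕ

⌊⌋-yes : ∀ {A : Set} (a? : Dec A) → A → ⌊ a? ⌋ ≡ true
⌊⌋-yes a? a = trans (isYes≗does a?) (dec-true a? a)

⌊⌋-true⇒ : ∀ {A : Set} (a? : Dec A) → ⌊ a? ⌋ ≡ true → A
⌊⌋-true⇒ (yes a) _ = a

∧≡true⇒ : ∀ a {b} → a ∧ b ≡ true → a ≡ true × b ≡ true
∧≡true⇒ true b≡true = refl , b≡true

xor≡false⇒≡ : ∀ a b → a xor b ≡ false → a ≡ b
xor≡false⇒≡ false false _ = refl
xor≡false⇒≡ true  true  _ = refl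

parity≡sum : (f : Fin n → Bool) → parity f ≡ sum f
parity≡sum {zero}  f = refl
parity≡sum {suc n} f = cong (f zero xor_) (parity≡sum (f ∘ suc))

count-parity : (f : Fin n → Bool) (b : Bool) → 2 ∣ (if b then 1 else 0) + count f → parity f ≡ b
count-parity {zero}  f false _   = refl
count-parity {zero}  f true  2∣1 = contradiction (∣1⇒≡1 2∣1) λ ()
count-parity {suc n} f b 2∣ with f zero
count-parity {suc n} f b     2∣ | false = count-parity (f ∘ suc) b 2∣
count-parity {suc n} f false 2∣ | true  = cong not (count-parity (f ∘ suc) true 2∣)
count-parity {suc n} f true  2∣ | true  = cong not (count-parity (f ∘ suc) false (∣m+n∣m⇒∣n 2∣ ∣-refl))

sum-zero : (f : Fin n → Bool) → (∀ i → f i ≡ false) → sum f ≡ false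
sum-zero {n} f f≗0 = trans (sum-cong-≗ f≗0) (sum-replicate-zero n)

sum-single : (f : Fin n → Bool) (p : Fin n) → (∀ i → i ≢ p → f i ≡ false) → sum f ≡ f p
sum-single {suc n} f p vanish = begin
  sum f                       ≡⟨ sum-remove {i = p} f ⟩
  f p xor sum (removeAt f p)  ≡⟨ cong (f p xor_) (sum-zero _ (λ i → vanish _ (punchInᵢ≢i p i))) ⟩
  f p xor false               ≡⟨ xor-identityʳ (f p) ⟩
  f p                         ∎

sum-pair : (f : Fin n → Bool) {p q : Fin n} → p ≢ q →
           (∀ i → i ≢ p → i ≢ q → f i ≡ false) → sum f ≡ f p xor f q
sum-pair {suc n} f {p} {q} p≢q vanish = begin
  sum f                                 ≡⟨ sum-remove {i = p} f ⟩
  f p xor sum (removeAt f p)            ≡⟨ cong (f p xor_) (sum-single (removeAt f p) q′ vanish′) ⟩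
  f p xor f (punchIn p q′)              ≡⟨ cong (λ i → f p xor f i) (punchIn-punchOut p≢q) ⟩
  f p xor f q                           ∎
  where
  q′ : Fin n
  q′ = punchOut p≢q
  vanish′ : ∀ i → i ≢ q′ → f (punchIn p i) ≡ false
  vanish′ i i≢q′ = vanish _ (punchInᵢ≢i p i) λ eq →
    i≢q′ (punchIn-injective p i q′ (trans eq (sym (punchIn-punchOut p≢q))))

sum≡true⇒∃ : (f : Fin n → Bool) → sum f ≡ true → ∃ λ i → f i ≡ true
sum≡true⇒∃ {zero}  f ()
sum≡true⇒∃ {suc n} f Σf with f zero in f0
... | true  = zero , f0
... | false = let i , fi = sum≡true⇒∃ (f ∘ suc) Σf in suc i , fi

sum≡false⇒∃≢ : (f : Fin n → Bool) {p : Fin n} → sum f ≡ false → f p ≡ true →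
               ∃ λ i → i ≢ p × f i ≡ true
sum≡false⇒∃≢ {suc n} f {p} Σf fp =
  let i , fi = sum≡true⇒∃ (removeAt f p) rest in punchIn p i , punchInᵢ≢i p i , fi
  where
  rest : sum (removeAt f p) ≡ true
  rest = not-injective {y = true} (begin
    not (sum (removeAt f p))    ≡⟨ cong (_xor sum (removeAt f p)) fp ⟨
    f p xor sum (removeAt f p)  ≡⟨ sum-remove {i = p} f ⟨
    sum f                       ≡⟨ Σf ⟩
    false                       ∎)

module _ (P : FinPoset n) (rk : Fin n → ℕ) where
  open FinPoset P

  bd≡sum : (ζ : Fin n → Bool) (z : Fin n) → bd P rk ζ z ≡ sum (λ x → ζ x ∧ ⌊ z ⋖? x ⌋)
  bd≡sum ζ z = parity≡sum (λ x → ζ x ∧ ⌊ z ⋖? x ⌋)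

  bd-xor : (ζ θ : Fin n → Bool) (z : Fin n) →
           bd P rk (λ x → ζ x xor θ x) z ≡ bd P rk ζ z xor bd P rk θ z
  bd-xor ζ θ z = begin
    bd P rk (λ x → ζ x xor θ x) z                        ≡⟨ bd≡sum _ z ⟩
    sum (λ x → (ζ x xor θ x) ∧ ⌊ z ⋖? x ⌋)               ≡⟨ sum-cong-≗ (λ x → ∧-distribʳ-xor _ (ζ x) (θ x)) ⟩
    sum (λ x → (ζ x ∧ ⌊ z ⋖? x ⌋) xor (θ x ∧ ⌊ z ⋖? x ⌋)) ≡⟨ ∑-distrib-+ (λ x → ζ x ∧ ⌊ z ⋖? x ⌋) _ ⟩
    sum (λ x → ζ x ∧ ⌊ z ⋖? x ⌋) xor sum (λ x → θ x ∧ ⌊ z ⋖? x ⌋)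
                                                         ≡⟨ cong₂ _xor_ (bd≡sum ζ z) (bd≡sum θ z) ⟨
    bd P rk ζ z xor bd P rk θ z                          ∎

  xor-chain : ∀ {q ζ θ} → IsChain P rk q ζ → IsChain P rk q θ → IsChain P rk q (λ x → ζ x xor θ x)
  xor-chain {ζ = ζ} ζ-chain θ-chain x eq with ζ x in ζx
  ... | true  = ζ-chain x ζx
  ... | false = θ-chain x eq

  bd≡true⇒cover : (ζ : Fin n → Bool) {z : Fin n} → bd P rk ζ z ≡ true →
                   ∃ λ y → ζ y ≡ true × z ⋖ y
  bd≡true⇒cover ζ {z} eq =
    let y , t = sum≡true⇒∃ _ (trans (sym (bd≡sum ζ z)) eq)
        ζy , z⋖?y = ∧≡true⇒ (ζ y) t
    in y , ζy , ⌊⌋-true⇒ (z ⋖? y) z⋖?y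

  bd≡false⇒another-cover : (ζ : Fin n → Bool) {z x : Fin n} → bd P rk ζ z ≡ false →
                            ζ x ≡ true → z ⋖ x → ∃ λ x′ → x′ ≢ x × ζ x′ ≡ true × z ⋖ x′
  bd≡false⇒another-cover ζ {z} {x} eq ζx z⋖x =
    let x′ , x′≢x , t = sum≡false⇒∃≢ _ (trans (sym (bd≡sum ζ z)) eq)
                                        (cong₂ _∧_ ζx (⌊⌋-yes (z ⋖? x) z⋖x))
        ζx′ , z⋖?x′ = ∧≡true⇒ (ζ x′) t
    in x′ , x′≢x , ζx′ , ⌊⌋-true⇒ (z ⋖? x′) z⋖?x′

  record TwoCovers (x y : Fin n) : Set where
    field
      ⋖y      : x ⋖ y
      other   : Fin n
      ⋖other  : x ⋖ other
      other≢y : other ≢ y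
      covers  : ∀ z → x ⋖ z → z ≡ y ⊎ z ≡ other

  bd-two-covers : ∀ {x y} (ζ : Fin n → Bool) (c : TwoCovers x y) →
                  bd P rk ζ x ≡ ζ y xor ζ (TwoCovers.other c)
  bd-two-covers {x} {y} ζ c = begin
    bd P rk ζ x                                          ≡⟨ bd≡sum ζ x ⟩
    sum (λ z → ζ z ∧ ⌊ x ⋖? z ⌋)                         ≡⟨ sum-pair _ (other≢y ∘ sym) vanish ⟩
    (ζ y ∧ ⌊ x ⋖? y ⌋) xor (ζ other ∧ ⌊ x ⋖? other ⌋)   ≡⟨ cong₂ _xor_ (on-cover ⋖y) (on-cover ⋖other) ⟩
    ζ y xor ζ other                                      ∎
    where
    open TwoCovers c
    on-cover : ∀ {z} → x ⋖ z → ζ z ∧ ⌊ x ⋖? z ⌋ ≡ ζ z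
    on-cover {z} x⋖z = trans (cong (ζ z ∧_) (⌊⌋-yes (x ⋖? z) x⋖z)) (∧-identityʳ (ζ z))
    vanish : ∀ z → z ≢ y → z ≢ other → ζ z ∧ ⌊ x ⋖? z ⌋ ≡ false
    vanish z z≢y z≢other with x ⋖? z
    ... | no _ = ∧-zeroʳ (ζ z)
    ... | yes x⋖z with covers z x⋖z
    ...   | inj₁ z≡y     = contradiction z≡y z≢y
    ...   | inj₂ z≡other = contradiction z≡other z≢other

  -- b , x , a are consecutive entries y₀ , x₁ , y₁ of an M-path.
  Step : (Fin n → Fin n → Bool) → Rel (Fin n) 0ℓ
  Step M b a = ∃ λ x → InPair P rk M x a × x ⋖ b × b ≢ a

  step⁺⇒path : ∀ {M b a} → TransClosure (Step M) b a → ∃ λ r → MPath P rk M b a (suc r)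
  step⁺⇒path [ _ , p , c , ne ]     = 0 , step p c ne (stop _)
  step⁺⇒path ((_ , p , c , ne) ∷ s) = let r , path = step⁺⇒path s in suc r , step p c ne path

  acyclic⇒wellFounded : ∀ {M} → Acyclic P rk M → WellFounded (Step M)
  acyclic⇒wellFounded {M} acyclic = wellFounded⁻ (Step M) (spo-wellFounded step⁺-isSPO)
    where
    step⁺-isSPO : IsStrictPartialOrder _≡_ (TransClosure (Step M))
    step⁺-isSPO = record
      { isEquivalence = isEquivalence
      ; irrefl        = λ { refl s → let r , cycle = step⁺⇒path s in acyclic _ r cycle }
      ; trans         = _++_
      ; <-resp-≈      = resp₂ _
      }

module SphereLikePoset (P : FinPoset n) (rk : Fin n → ℕ) (k : ℕ)
                       (ranked : IsRanked P rk) (sphere : SphereLike P rk k) where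
  open FinPoset P
  open IsRanked ranked
  open SphereLike sphere

  rank-below-top : ∀ {x y} → rk y ≡ k → x ⋖ y → rk x ≡ k ∸ 1
  rank-below-top rky x⋖y = cong (_∸ 1) (trans (sym (rk-cover x⋖y)) rky)

  rank-above-facet : ∀ {x y} → rk x ≡ k ∸ 1 → x ⋖ y → rk y ≡ k
  rank-above-facet rkx x⋖y = trans (rk-cover x⋖y) (trans (cong suc rkx) (m+[n∸m]≡n (<⇒≤ k≥2)))

  rank-two-below-top : ∀ {w x y} → rk y ≡ k → w ⋖ x → x ⋖ y → rk w ≡ k ∸ 2
  rank-two-below-top rky w⋖x x⋖y =
    cong (_∸ 2) (trans (sym (trans (rk-cover x⋖y) (cong suc (rk-cover w⋖x)))) rky)

  even-intervals : ∀ {y} → rk y ≡ k → (w : Fin n) → sum (λ x → ⌊ x ⋖? y ⌋ ∧ ⌊ w ⋖? x ⌋) ≡ false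
  even-intervals {y} rky w with rk w ≟ k ∸ 2
  ... | no rkw≢k-2 = sum-zero _ no-interval
    where
    no-interval : ∀ x → ⌊ x ⋖? y ⌋ ∧ ⌊ w ⋖? x ⌋ ≡ false
    no-interval x with x ⋖? y | w ⋖? x
    ... | yes x⋖y | yes w⋖x = contradiction (rank-two-below-top rky w⋖x x⋖y) rkw≢k-2
    ... | yes _   | no _    = refl
    ... | no _    | _       = refl
  ... | yes rkw = begin
    sum (λ x → ⌊ x ⋖? y ⌋ ∧ ⌊ w ⋖? x ⌋)  ≡⟨ sum-cong-≗ as-diamond ⟩
    sum in-diamond                        ≡⟨ parity≡sum in-diamond ⟨
    parity in-diamond                     ≡⟨ count-parity in-diamond false (diamond y w rky rkw) ⟩
    false                                 ∎
    where
    in-diamond : Fin n → Bool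
    in-diamond x = ⌊ rk x ≟ (k ∸ 1) ⌋ ∧ ⌊ w ⋖? x ⌋ ∧ ⌊ x ⋖? y ⌋
    as-diamond : ∀ x → ⌊ x ⋖? y ⌋ ∧ ⌊ w ⋖? x ⌋ ≡ in-diamond x
    as-diamond x with x ⋖? y
    ... | no _ = sym (trans (cong (⌊ rk x ≟ (k ∸ 1) ⌋ ∧_) (∧-zeroʳ _)) (∧-zeroʳ _))
    ... | yes x⋖y rewrite ⌊⌋-yes (rk x ≟ (k ∸ 1)) (rank-below-top rky x⋖y) = sym (∧-identityʳ _)

  bd∘bd≡0 : ∀ {ζ} → IsChain P rk k ζ → ∀ w → bd P rk (bd P rk ζ) w ≡ false
  bd∘bd≡0 {ζ} ζ-chain w = begin
    bd P rk (bd P rk ζ) w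
      ≡⟨ bd≡sum P rk (bd P rk ζ) w ⟩
    sum (λ x → bd P rk ζ x ∧ ⌊ w ⋖? x ⌋)
      ≡⟨ sum-cong-≗ (λ x → cong (_∧ ⌊ w ⋖? x ⌋) (bd≡sum P rk ζ x)) ⟩
    sum (λ x → sum (λ y → ζ y ∧ ⌊ x ⋖? y ⌋) ∧ ⌊ w ⋖? x ⌋)
      ≡⟨ sum-cong-≗ (λ x → *-distribʳ-sum ⌊ w ⋖? x ⌋ (λ y → ζ y ∧ ⌊ x ⋖? y ⌋)) ⟩
    sum (λ x → sum (λ y → (ζ y ∧ ⌊ x ⋖? y ⌋) ∧ ⌊ w ⋖? x ⌋))
      ≡⟨ ∑-comm (λ x y → (ζ y ∧ ⌊ x ⋖? y ⌋) ∧ ⌊ w ⋖? x ⌋) ⟩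
    sum (λ y → sum (λ x → (ζ y ∧ ⌊ x ⋖? y ⌋) ∧ ⌊ w ⋖? x ⌋))
      ≡⟨ sum-cong-≗ (λ y → sum-cong-≗ (λ x → ∧-assoc (ζ y) ⌊ x ⋖? y ⌋ ⌊ w ⋖? x ⌋)) ⟩
    sum (λ y → sum (λ x → ζ y ∧ (⌊ x ⋖? y ⌋ ∧ ⌊ w ⋖? x ⌋)))
      ≡⟨ sum-cong-≗ (λ y → *-distribˡ-sum (ζ y) (λ x → ⌊ x ⋖? y ⌋ ∧ ⌊ w ⋖? x ⌋)) ⟨
    sum (λ y → ζ y ∧ sum (λ x → ⌊ x ⋖? y ⌋ ∧ ⌊ w ⋖? x ⌋))
      ≡⟨ sum-zero _ term-vanishes ⟩
    false
      ∎
    where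
    term-vanishes : ∀ y → ζ y ∧ sum (λ x → ⌊ x ⋖? y ⌋ ∧ ⌊ w ⋖? x ⌋) ≡ false
    term-vanishes y with ζ y in ζy
    ... | false = refl
    ... | true  = even-intervals (ζ-chain y ζy) w

  bd-chain : ∀ {ζ} → IsChain P rk k ζ → IsChain P rk (k ∸ 1) (bd P rk ζ)
  bd-chain {ζ} ζ-chain x eq =
    let y , ζy , x⋖y = bd≡true⇒cover P rk ζ eq in rank-below-top (ζ-chain y ζy) x⋖y

  facet-two-covers : ∀ {x y} → rk x ≡ k ∸ 1 → x ⋖ y → TwoCovers P rk x y
  facet-two-covers {x} {y} rkx x⋖y with two-covers x rkx
  ... | y₁ , y₂ , y₁≢y₂ , x⋖y₁ , x⋖y₂ , covers with covers y x⋖y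
  ...   | inj₁ refl = record { ⋖y = x⋖y ; other = y₂ ; ⋖other = x⋖y₂
                             ; other≢y = y₁≢y₂ ∘ sym ; covers = covers }
  ...   | inj₂ refl = record { ⋖y = x⋖y ; other = y₁ ; ⋖other = x⋖y₁
                             ; other≢y = y₁≢y₂ ; covers = λ z → swap ∘ covers z }

  M : Fin n → Fin n → Bool
  M = proj₁ matching

  open IsMatching (proj₁ (proj₂ matching))

  step-wellFounded : WellFounded (Step P rk M)
  step-wellFounded = acyclic⇒wellFounded P rk (proj₁ (proj₂ (proj₂ matching)))

  facet-not-critical : ∀ x → rk x ≡ k ∸ 1 → ¬ Critical P rk M x
  facet-not-critical = proj₂ (proj₂ (proj₂ matching))

  cycle-vanishes : ∀ {θ} → IsChain P rk (k ∸ 1) θ → (∀ z → bd P rk θ z ≡ false) →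
                   (∀ {x y} → rk x ≡ k ∸ 1 → InPair P rk M x y → θ x ≡ false) →
                   ∀ x → θ x ≡ false
  cycle-vanishes {θ} θ-chain θ-cycle θ-matched-up =
    All.wfRec step-wellFounded 0ℓ (λ x → θ x ≡ false) λ x ih → ¬-not (unsupported x ih)
    where
    unsupported : ∀ x → WfRec (Step P rk M) (λ x → θ x ≡ false) x → θ x ≢ true
    unsupported x ih θx with any? (λ a → M a x Bool.≟ true)
    ... | no not-matched-down =
      facet-not-critical x (θ-chain x θx)
        ( (λ y p → contradiction (trans (sym θx) (θ-matched-up (θ-chain x θx) p)) λ ())
        , (λ a p → not-matched-down (a , p)) )
    ... | yes (a , p) =
      let x′ , x′≢x , θx′ , a⋖x′ = bd≡false⇒another-cover P rk θ (θ-cycle a) θx (pair-cover p)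
      in contradiction (trans (sym θx′) (ih (a , p , a⋖x′ , x′≢x))) λ ()

  TopMatched : Fin n → Set
  TopMatched y = rk y ≡ k × ∃ λ x → InPair P rk M x y

  topMatched? : ∀ y → Dec (TopMatched y)
  topMatched? y = (rk y ≟ k) ×-dec any? (λ x → M x y Bool.≟ true)

  matched-two-covers : ∀ {y} ((_ , x , _) : TopMatched y) → TwoCovers P rk x y
  matched-two-covers (rky , x , p) = facet-two-covers (rank-below-top rky (pair-cover p)) (pair-cover p)

  step-from-other : ∀ {y} (t : TopMatched y) → Step P rk M (TwoCovers.other (matched-two-covers t)) y
  step-from-other t@(_ , x , p) = x , p , ⋖other , other≢y
    where open TwoCovers (matched-two-covers t)

  module Filling (η : Fin n → Bool) where

    filling-step : ∀ y → WfRec (Step P rk M) (λ _ → Bool) y → Bool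
    filling-step y rec with topMatched? y
    ... | yes t@(_ , x , _) = η x xor rec (step-from-other t)
    ... | no _              = false

    filling-step-ext : ∀ y {rec rec′ : WfRec (Step P rk M) (λ _ → Bool) y} →
                       (∀ {b} (s : Step P rk M b y) → rec {b} s ≡ rec′ {b} s) →
                       filling-step y rec ≡ filling-step y rec′
    filling-step-ext y rec≗rec′ with topMatched? y
    ... | yes t@(_ , x , _) = cong (η x xor_) (rec≗rec′ (step-from-other t))
    ... | no _              = refl

    filling : Fin n → Bool
    filling = All.wfRec step-wellFounded 0ℓ (λ _ → Bool) filling-step

    filling-unfold : ∀ {y} → filling y ≡ filling-step y (λ {b} _ → filling b)
    filling-unfold = FixPoint.unfold-wfRec step-wellFounded (λ _ → Bool) filling-step filling-step-ext

    filling-step-chain : ∀ y {rec : WfRec (Step P rk M) (λ _ → Bool) y} → filling-step y rec ≡ true → rk y ≡ k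
    filling-step-chain y eq with topMatched? y
    ... | yes (rky , _) = rky
    ... | no _          = contradiction eq λ ()

    filling-chain : IsChain P rk k filling
    filling-chain y eq = filling-step-chain y (trans (sym filling-unfold) eq)

    filling-step-matched : ∀ {x y} → rk y ≡ k → InPair P rk M x y →
      Σ (TwoCovers P rk x y) λ c → filling-step y (λ {b} _ → filling b) ≡ η x xor filling (TwoCovers.other c)
    filling-step-matched {x} {y} rky p with topMatched? y
    ... | no ¬t = contradiction (rky , x , p) ¬t
    ... | yes t@(_ , x′ , p′) with at-most-one p′ p (inj₂ (inj₂ (inj₂ refl)))
    ...   | refl , _ = matched-two-covers t , refl

    bd-filling-matched : ∀ {x y} → rk x ≡ k ∸ 1 → InPair P rk M x y → bd P rk filling x ≡ η x
    bd-filling-matched {x} {y} rkx p =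
      let c , eq = filling-step-matched (rank-above-facet rkx (pair-cover p)) p
          o = TwoCovers.other c
      in begin
        bd P rk filling x                  ≡⟨ bd-two-covers P rk filling c ⟩
        filling y xor filling o            ≡⟨ cong (_xor filling o) (trans filling-unfold eq) ⟩
        (η x xor filling o) xor filling o  ≡⟨ xor-assoc (η x) (filling o) (filling o) ⟩
        η x xor (filling o xor filling o)  ≡⟨ cong (η x xor_) (xor-same (filling o)) ⟩
        η x xor false                      ≡⟨ xor-identityʳ (η x) ⟩
        η x                                ∎

lemma3p3 : ∀ {n} (P : FinPoset n) (rk : Fin n → ℕ) (k : ℕ) →
    IsRanked P rk → SphereLike P rk k →
    (η : Fin n → Bool) → IsChain P rk (k ∸ 1) η → (∀ z → bd P rk η z ≡ false) →
    Σ (Fin n → Bool) λ ξ → IsChain P rk k ξ × (∀ z → bd P rk ξ z ≡ η z)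
lemma3p3 {n} P rk k ranked sphere η η-chain η-cycle =
  filling , filling-chain , λ z → sym (xor≡false⇒≡ (η z) (bd P rk filling z) (θ≡0 z))
  where
  open SphereLikePoset P rk k ranked sphere
  open Filling η
  θ : Fin n → Bool
  θ z = η z xor bd P rk filling z

  θ-cycle : ∀ w → bd P rk θ w ≡ false
  θ-cycle w = begin
    bd P rk θ w                                        ≡⟨ bd-xor P rk η (bd P rk filling) w ⟩
    bd P rk η w xor bd P rk (bd P rk filling) w        ≡⟨ cong₂ _xor_ (η-cycle w) (bd∘bd≡0 filling-chain w) ⟩
    false                                              ∎

  θ-matched-up : ∀ {x y} → rk x ≡ k ∸ 1 → InPair P rk M x y → θ x ≡ false
  θ-matched-up {x} rkx p = trans (cong (η x xor_) (bd-filling-matched rkx p)) (xor-same (η x))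

  θ≡0 : ∀ z → θ z ≡ false
  θ≡0 = cycle-vanishes (xor-chain P rk η-chain (bd-chain filling-chain)) θ-cycle θ-matched-up
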